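{- Let $n\in\mathbb{N}_0$. Then \[ \sum_{k=0}^{n}(-1)^{k}\int_{\mathbb{Z}_p}\mathfrak{b}_k^n(x)\,d\mu_1(x)=\sum_{j=0}^{n}\sum_{m=0}^{n-j}\binom{n}{j}(-1)^{n+m-j}2^{n-j}S_2(n-j,m)\frac{m!}{m+1}. \]
   Context: $p$ is an odd prime. For a polynomial $f:\mathbb{Z}_p\to\mathbb{C}_p$ the Volkenborn integral is $\int_{\mathbb{Z}_p} f(x)\,d\mu_1(x)=\lim_{N\to\infty}p^{ -N}\sum_{x=0}^{p^N-1}f(x)$. The Bernstein basis polynomials are $\mathfrak{b}_k^n(x)=\binom{n}{k}x^k(1-x)^{n-k}$ for $0\le k\le n$. The Stirling numbers of the second kind $S_2(n,m)$ are defined by $x^n=\sum_{m=0}^n S_2(n,m)\,x(x-1)\cdots(x-m+1)$. -}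

module Defs where

open import Data.Nat as ℕ using (ℕ; zero; suc; NonZero; _!)
open import Data.Nat.Properties using (m^n≢0)
open import Data.Nat.Primality using (Prime; prime⇒nonZero)
open import Data.Nat.Divisibility using (_∣_)
open import Data.Nat.Combinatorics using (_C_)
open import Data.Integer as ℤ using (ℤ; +_)
open import Data.Rational as ℚ using (ℚ; _+_; _*_; _-_; -_; _/_; ↥_)
open import Data.Product using (∃-syntax)

_^ℚ_ : ℚ → ℕ → ℚ
q ^ℚ zero  = ℚ.1ℚ
q ^ℚ suc n = q * (q ^ℚ n)

ι : ℕ → ℚ
ι n = (+ n) / 1

Σ< : ℕ → (ℕ → ℚ) → ℚ
Σ< zero    f = ℚ.0ℚ
Σ< (suc n) f = Σ< n f + f n

Σ≤ : ℕ → (ℕ → ℚ) → ℚ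
Σ≤ n f = Σ< (suc n) f

bernstein : ℕ → ℕ → ℚ → ℚ
bernstein k n x = ι (n C k) * (x ^ℚ k) * ((ℚ.1ℚ - x) ^ℚ (n ℕ.∸ k))

-- Stirling numbers of the second kind, via the standard recurrence
-- S2(n+1,m+1) = (m+1) S2(n,m+1) + S2(n,m), S2(0,0)=1, S2(n+1,0)=S2(0,m+1)=0.
-- (These are exactly the coefficients in x^n = Σ_m S2(n,m) x(x-1)...(x-m+1).)
S₂ : ℕ → ℕ → ℕ
S₂ zero    zero    = 1
S₂ zero    (suc m) = 0
S₂ (suc n) zero    = 0
S₂ (suc n) (suc m) = suc m ℕ.* S₂ n (suc m) ℕ.+ S₂ n m

volkenbornSum : (p : ℕ) → Prime p → (ℚ → ℚ) → ℕ → ℚ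
volkenbornSum p pp f N =
  Σ< (p ℕ.^ N) (λ x → f (ι x)) * ((+ 1) / (p ℕ.^ N))
  where instance
    _ = prime⇒nonZero pp
    _ = m^n≢0 p N

-- p-adic convergence of a rational sequence a to a rational L:
-- |a N - L|_p → 0, i.e. for every M, eventually p^M divides the (reduced)
-- numerator of a N - L  (equivalently v_p(a N - L) ≥ M).
ConvergesPAdic : ℕ → (ℕ → ℚ) → ℚ → Set
ConvergesPAdic p a L =
  ∀ (M : ℕ) → ∃[ N₀ ] ∀ (N : ℕ) → N₀ ℕ.≤ N → (p ℕ.^ M) ∣ ℤ.∣ ↥ (a N - L) ∣

IsVolkenbornIntegral : (p : ℕ) → Prime p → (ℚ → ℚ) → ℚ → Set
IsVolkenbornIntegral p pp f I = ConvergesPAdic p (volkenbornSum p pp f) I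

sgn : ℕ → ℚ
sgn k = (- ℚ.1ℚ) ^ℚ k

rhs7 : ℕ → ℚ
rhs7 n = Σ≤ n (λ j → Σ≤ (n ℕ.∸ j) (λ m →
  ι (n C j) * sgn (n ℕ.+ m ℕ.∸ j) * (ι 2 ^ℚ (n ℕ.∸ j))
    * ι (S₂ (n ℕ.∸ j) m) * ((+ (m !)) / suc m)))

{-# OPTIONS --safe #-}
-- Write every polynomial that is integer-valued on ℕ in the Mahler basis x ↦ (x choose j).
-- By the hockey-stick identity, Σ_{x<M} (x choose j) = (M choose (j + 1)) = M (-1)^j/(j + 1) + M² R_j(M),
-- where R_j(M) has a denominator bounded independently of M. Hence the Riemann sum
-- p^(-N) Σ_{x<p^N} P(x) differs from Σ_j c_j (-1)^j/(j + 1) by p^N times a rational of bounded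
-- denominator, so it converges p-adically to that value. On the algebraic side
-- Σ_k (-1)^k b_k^n(x) = (1 - 2x)^n = Σ_j C(n,j) (-2x)^(n-j), and x^r = Σ_m m! S₂(r,m) (x choose m).
-- Mahler coefficients are determined by the values on ℕ, so both sides have the same integral,
-- and integrating the right-hand side term by term gives the stated double sum.
module Submission where

open import Algebra.Bundles using (CommutativeRing)
import Algebra.Properties.CommutativeSemiring.Binomial as Binomial
import Algebra.Properties.Semiring.Mult as SemiringMult
import Algebra.Properties.Semiring.Sum as SemiringSum
open import Data.Empty using (⊥-elim)
open import Data.Fin using (toℕ)
open import Data.Integer as ℤ using (ℤ; +_)
import Data.Integer.Properties as ℤP
import Data.Integer.Solver as ℤSolver
open import Data.List using (List; []; _∷_; length)
open import Data.Nat as ℕ using (ℕ; zero; suc; _∸_; _!; _≤_; NonZero)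
open import Data.Nat.Combinatorics using (_C_)
open import Data.Nat.Divisibility
  using (_∣_; divides; _∣?_; ∣-trans; 1∣_; m∣m*n; ∣m⇒∣m*n; *-monoʳ-∣; *-cancelˡ-∣)
open import Data.Nat.Primality using (Prime; prime⇒nonZero; prime⇒nonTrivial; euclidsLemma)
import Data.Nat.Properties as ℕP
import Data.Nat.Solver as ℕSolver
open import Data.Product using (Σ; _×_; _,_; ∃-syntax)
open import Data.Rational as ℚ using (ℚ; _+_; _*_; _-_; -_; _/_; ↥_; ↧_; 0ℚ; 1ℚ)
import Data.Rational.Properties as ℚP
open import Data.Rational.Solver using (module +-*-Solver)
import Data.Rational.Unnormalised as ℚᵘ
import Data.Rational.Unnormalised.Properties as ℚᵘP
open import Data.Sum using (inj₁; inj₂)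
open import Relation.Nullary using (¬_; yes; no)
open import Relation.Binary.PropositionalEquality

open import Defs

ιℤ : ℤ → ℚ
ιℤ z = z / 1

toℚᵘ-/ : ∀ z d → ℚ.toℚᵘ (z / suc d) ℚᵘ.≃ ℚᵘ.mkℚᵘ z d
toℚᵘ-/ z d = ℚP.toℚᵘ-fromℚᵘ (ℚᵘ.mkℚᵘ z d)

ιℤ-+ : ∀ a b → ιℤ (a ℤ.+ b) ≡ ιℤ a + ιℤ b
ιℤ-+ a b = ℚP.toℚᵘ-injective (begin-equality
  ℚ.toℚᵘ (ιℤ (a ℤ.+ b))              ≃⟨ toℚᵘ-/ (a ℤ.+ b) 0 ⟩
  ℚᵘ.mkℚᵘ (a ℤ.+ b) 0                ≃⟨ ℚᵘ.*≡* (solve 2 (λ a b → (a :+ b) :* one := (a :* one :+ b :* one) :* one)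
                                                        refl a b) ⟩
  ℚᵘ.mkℚᵘ a 0 ℚᵘ.+ ℚᵘ.mkℚᵘ b 0       ≃⟨ ℚᵘP.+-cong (toℚᵘ-/ a 0) (toℚᵘ-/ b 0) ⟨
  ℚ.toℚᵘ (ιℤ a) ℚᵘ.+ ℚ.toℚᵘ (ιℤ b)   ≃⟨ ℚP.toℚᵘ-homo-+ (ιℤ a) (ιℤ b) ⟨
  ℚ.toℚᵘ (ιℤ a + ιℤ b)               ∎)
  where
  open ℚᵘP.≤-Reasoning
  open ℤSolver.+-*-Solver
  one = con (+ 1)

ιℤ-* : ∀ a b → ιℤ (a ℤ.* b) ≡ ιℤ a * ιℤ b
ιℤ-* a b = ℚP.toℚᵘ-injective (begin-equality
  ℚ.toℚᵘ (ιℤ (a ℤ.* b))              ≃⟨ toℚᵘ-/ (a ℤ.* b) 0 ⟩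
  ℚᵘ.mkℚᵘ (a ℤ.* b) 0                ≃⟨ ℚᵘP.*-cong (toℚᵘ-/ a 0) (toℚᵘ-/ b 0) ⟨
  ℚ.toℚᵘ (ιℤ a) ℚᵘ.* ℚ.toℚᵘ (ιℤ b)   ≃⟨ ℚP.toℚᵘ-homo-* (ιℤ a) (ιℤ b) ⟨
  ℚ.toℚᵘ (ιℤ a * ιℤ b)               ∎)
  where open ℚᵘP.≤-Reasoning

ιℤ-neg : ∀ a → ιℤ (ℤ.- a) ≡ - ιℤ a
ιℤ-neg a = ℚP.toℚᵘ-injective (begin-equality
  ℚ.toℚᵘ (ιℤ (ℤ.- a))   ≃⟨ toℚᵘ-/ (ℤ.- a) 0 ⟩
  ℚᵘ.mkℚᵘ (ℤ.- a) 0     ≃⟨ ℚᵘP.-‿cong (toℚᵘ-/ a 0) ⟨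
  ℚᵘ.- ℚ.toℚᵘ (ιℤ a)    ≃⟨ ℚP.toℚᵘ-homo‿- (ιℤ a) ⟨
  ℚ.toℚᵘ (- ιℤ a)       ∎)
  where open ℚᵘP.≤-Reasoning

1/[1+_] : ℕ → ℚ
1/[1+ m ] = + 1 / suc m

1/[1+m]*[1+m]≡1 : ∀ m → 1/[1+ m ] * ι (suc m) ≡ 1ℚ
1/[1+m]*[1+m]≡1 m = ℚP.toℚᵘ-injective (begin-equality
  ℚ.toℚᵘ (1/[1+ m ] * ι (suc m))             ≃⟨ ℚP.toℚᵘ-homo-* 1/[1+ m ] (ι (suc m)) ⟩
  ℚ.toℚᵘ 1/[1+ m ] ℚᵘ.* ℚ.toℚᵘ (ι (suc m))   ≃⟨ ℚᵘP.*-cong (toℚᵘ-/ (+ 1) m) (toℚᵘ-/ (+ suc m) 0) ⟩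
  ℚᵘ.mkℚᵘ (+ 1) m ℚᵘ.* ℚᵘ.mkℚᵘ (+ suc m) 0   ≃⟨ ℚᵘ.*≡* (cong ℤ.+[1+_] (ℕP.*-distribʳ-+ 1 m 0)) ⟩
  ℚ.toℚᵘ 1ℚ                                  ∎)
  where open ℚᵘP.≤-Reasoning

/suc≡*1/[1+_] : ∀ a m → + a / suc m ≡ ι a * 1/[1+ m ]
/suc≡*1/[1+_] a m = ℚP.toℚᵘ-injective (begin-equality
  ℚ.toℚᵘ (+ a / suc m)                    ≃⟨ toℚᵘ-/ (+ a) m ⟩
  ℚᵘ.mkℚᵘ (+ a) m                         ≃⟨ ℚᵘ.*≡* cross ⟩
  ℚᵘ.mkℚᵘ (+ a) 0 ℚᵘ.* ℚᵘ.mkℚᵘ (+ 1) m    ≃⟨ ℚᵘP.*-cong (toℚᵘ-/ (+ a) 0) (toℚᵘ-/ (+ 1) m) ⟨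
  ℚ.toℚᵘ (ι a) ℚᵘ.* ℚ.toℚᵘ 1/[1+ m ]      ≃⟨ ℚP.toℚᵘ-homo-* (ι a) 1/[1+ m ] ⟨
  ℚ.toℚᵘ (ι a * 1/[1+ m ])                ∎)
  where
  open ℚᵘP.≤-Reasoning
  cross : + a ℤ.* ℤ.+[1+ m ℕ.+ 0 ] ≡ + a ℤ.* + 1 ℤ.* + suc m
  cross = trans (cong (λ k → + a ℤ.* ℤ.+[1+ k ]) (ℕP.+-identityʳ m))
                (cong (ℤ._* + suc m) (sym (ℤP.*-identityʳ (+ a))))

*ι≡ιℤ⇒toℚᵘ : ∀ q d z → q * ι d ≡ ιℤ z → ℚ.toℚᵘ q ℚᵘ.* ℚᵘ.mkℚᵘ (+ d) 0 ℚᵘ.≃ ℚᵘ.mkℚᵘ z 0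
*ι≡ιℤ⇒toℚᵘ q d z eq = begin-equality
  ℚ.toℚᵘ q ℚᵘ.* ℚᵘ.mkℚᵘ (+ d) 0   ≃⟨ ℚᵘP.*-congˡ {ℚ.toℚᵘ q} (toℚᵘ-/ (+ d) 0) ⟨
  ℚ.toℚᵘ q ℚᵘ.* ℚ.toℚᵘ (ι d)      ≃⟨ ℚP.toℚᵘ-homo-* q (ι d) ⟨
  ℚ.toℚᵘ (q * ι d)                ≡⟨ cong ℚ.toℚᵘ eq ⟩
  ℚ.toℚᵘ (ιℤ z)                   ≃⟨ toℚᵘ-/ z 0 ⟩
  ℚᵘ.mkℚᵘ z 0                     ∎
  where open ℚᵘP.≤-Reasoning

cross-multiply : ∀ q d z → q * ι d ≡ ιℤ z → ↥ q ℤ.* + d ≡ z ℤ.* ↧ q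
cross-multiply q@record{} d z eq = begin
  ↥ q ℤ.* + d                               ≡⟨ ℤP.*-identityʳ (↥ q ℤ.* + d) ⟨
  ↥ q ℤ.* + d ℤ.* + 1                       ≡⟨ ℚᵘP.drop-*≡* (*ι≡ιℤ⇒toℚᵘ q d z eq) ⟩
  z ℤ.* ℤ.+[1+ ℚ.denominator-1 q ℕ.* 1 ]    ≡⟨ cong (λ k → z ℤ.* ℤ.+[1+ k ]) (ℕP.*-identityʳ (ℚ.denominator-1 q)) ⟩
  z ℤ.* ↧ q                                 ∎
  where open ≡-Reasoning

open ≡-Reasoning
open +-*-Solver

ι-+ : ∀ a b → ι (a ℕ.+ b) ≡ ι a + ι b
ι-+ a b = trans (cong ιℤ (ℤP.pos-+ a b)) (ιℤ-+ (+ a) (+ b))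

ι-* : ∀ a b → ι (a ℕ.* b) ≡ ι a * ι b
ι-* a b = trans (cong ιℤ (ℤP.pos-* a b)) (ιℤ-* (+ a) (+ b))

ι-^ : ∀ a n → ι (a ℕ.^ n) ≡ ι a ^ℚ n
ι-^ a zero    = refl
ι-^ a (suc n) = trans (ι-* a (a ℕ.^ n)) (cong (ι a *_) (ι-^ a n))

sgnℤ : ℕ → ℤ
sgnℤ zero    = + 1
sgnℤ (suc k) = ℤ.-1ℤ ℤ.* sgnℤ k

ιℤ-sgnℤ : ∀ k → ιℤ (sgnℤ k) ≡ sgn k
ιℤ-sgnℤ zero    = refl
ιℤ-sgnℤ (suc k) = trans (ιℤ-* ℤ.-1ℤ (sgnℤ k)) (cong (- 1ℚ *_) (ιℤ-sgnℤ k))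

Σ<-cong : ∀ n {f g} → (∀ i → f i ≡ g i) → Σ< n f ≡ Σ< n g
Σ<-cong zero    f≗g = refl
Σ<-cong (suc n) f≗g = cong₂ _+_ (Σ<-cong n f≗g) (f≗g n)

Σ<-cong-< : ∀ n {f g} → (∀ i → i ℕ.< n → f i ≡ g i) → Σ< n f ≡ Σ< n g
Σ<-cong-< zero    f≗g = refl
Σ<-cong-< (suc n) f≗g = cong₂ _+_ (Σ<-cong-< n (λ i i<n → f≗g i (ℕP.m<n⇒m<1+n i<n))) (f≗g n ℕP.≤-refl)

*-distribˡ-Σ< : ∀ n c f → c * Σ< n f ≡ Σ< n (λ i → c * f i)
*-distribˡ-Σ< zero    c f = ℚP.*-zeroʳ c
*-distribˡ-Σ< (suc n) c f =
  trans (ℚP.*-distribˡ-+ c (Σ< n f) (f n)) (cong (_+ c * f n) (*-distribˡ-Σ< n c f))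

Σ<-sucˡ : ∀ n f → Σ< (suc n) f ≡ f 0 + Σ< n (λ i → f (suc i))
Σ<-sucˡ zero    f = trans (ℚP.+-identityˡ (f 0)) (sym (ℚP.+-identityʳ (f 0)))
Σ<-sucˡ (suc n) f = trans (cong (_+ f (suc n)) (Σ<-sucˡ n f)) (ℚP.+-assoc (f 0) _ _)

^ℚ-distribˡ-+-* : ∀ q m n → q ^ℚ (m ℕ.+ n) ≡ q ^ℚ m * q ^ℚ n
^ℚ-distribˡ-+-* q zero    n = sym (ℚP.*-identityˡ _)
^ℚ-distribˡ-+-* q (suc m) n = trans (cong (q *_) (^ℚ-distribˡ-+-* q m n)) (sym (ℚP.*-assoc q _ _))

^ℚ-distribʳ-* : ∀ q r n → (q * r) ^ℚ n ≡ q ^ℚ n * r ^ℚ n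
^ℚ-distribʳ-* q r zero    = refl
^ℚ-distribʳ-* q r (suc n) = trans (cong ((q * r) *_) (^ℚ-distribʳ-* q r n))
  (solve 4 (λ q r a b → (q :* r) :* (a :* b) := (q :* a) :* (r :* b)) refl q r (q ^ℚ n) (r ^ℚ n))

1^ℚ≡1 : ∀ n → 1ℚ ^ℚ n ≡ 1ℚ
1^ℚ≡1 zero    = refl
1^ℚ≡1 (suc n) = cong (1ℚ *_) (1^ℚ≡1 n)

neg-^ℚ : ∀ q n → (- q) ^ℚ n ≡ sgn n * q ^ℚ n
neg-^ℚ q zero    = refl
neg-^ℚ q (suc n) = trans (cong ((- q) *_) (neg-^ℚ q n))
  (solve 3 (λ q s a → (:- q) :* (s :* a) := (con (- 1ℚ) :* s) :* (q :* a)) refl q (sgn n) (q ^ℚ n))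

module ℚ-Semiring where
  open CommutativeRing ℚP.+-*-commutativeRing public using (commutativeSemiring; semiring)
  open SemiringSum semiring public using (sum; sum-cong-≗)
  open SemiringMult semiring public using (_×_)
  open import Algebra.Properties.Semiring.Exp semiring public using (_^_)

Σ<≡sum : ∀ n f → Σ< n f ≡ ℚ-Semiring.sum {n} (λ i → f (toℕ i))
Σ<≡sum zero    f = refl
Σ<≡sum (suc n) f = trans (Σ<-sucˡ n f) (cong (λ s → f 0 + s) (Σ<≡sum n (λ i → f (suc i))))

×≡ι* : ∀ n q → n ℚ-Semiring.× q ≡ ι n * q
×≡ι* zero    q = sym (ℚP.*-zeroˡ q)
×≡ι* (suc n) q = begin
  q + n ℚ-Semiring.× q   ≡⟨ cong (λ s → q + s) (×≡ι* n q) ⟩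
  q + ι n * q            ≡⟨ solve 2 (λ q m → q :+ m :* q := (con 1ℚ :+ m) :* q) refl q (ι n) ⟩
  (1ℚ + ι n) * q         ≡⟨ cong (_* q) (ι-+ 1 n) ⟨
  ι (suc n) * q          ∎

^≡^ℚ : ∀ q n → q ℚ-Semiring.^ n ≡ q ^ℚ n
^≡^ℚ q zero    = refl
^≡^ℚ q (suc n) = cong (q *_) (^≡^ℚ q n)

binomial-theorem : ∀ n a b → (a + b) ^ℚ n ≡ Σ≤ n (λ k → ι (n C k) * (a ^ℚ k * b ^ℚ (n ∸ k)))
binomial-theorem n a b = begin
  (a + b) ^ℚ n                        ≡⟨ ^≡^ℚ (a + b) n ⟨
  (a + b) ℚ-Semiring.^ n              ≡⟨ Binomial.theorem ℚ-Semiring.commutativeSemiring n a b ⟩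
  Binomial.binomialExpansion S a b n  ≡⟨ ℚ-Semiring.sum-cong-≗ {suc n} term ⟩
  ℚ-Semiring.sum {suc n} (λ k → t (toℕ k)) ≡⟨ Σ<≡sum (suc n) t ⟨
  Σ≤ n t                              ∎
  where
  S = ℚ-Semiring.commutativeSemiring
  t : ℕ → ℚ
  t k = ι (n C k) * (a ^ℚ k * b ^ℚ (n ∸ k))
  term : ∀ k → Binomial.binomialTerm S a b n k ≡ t (toℕ k)
  term k = trans (×≡ι* (n C toℕ k) _)
                 (cong (ι (n C toℕ k) *_) (cong₂ _*_ (^≡^ℚ a (toℕ k)) (^≡^ℚ b (n ∸ toℕ k))))

-- Pascal's rule as the definition, so that it holds by computation (unlike for `_C_`).
_choose_ : ℕ → ℕ → ℕ
n     choose zero  = 1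
zero  choose suc k = 0
suc n choose suc k = n choose k ℕ.+ n choose suc k

choose-1 : ∀ n → n choose 1 ≡ n
choose-1 zero    = refl
choose-1 (suc n) = cong suc (choose-1 n)

choose-absorption : ∀ x k → suc k ℕ.* (suc x choose suc k) ≡ suc x ℕ.* (x choose k)
choose-absorption zero    zero    = refl
choose-absorption zero    (suc k) = ℕP.*-zeroʳ (suc (suc k))
choose-absorption (suc x) zero    =
  cong suc (trans (ℕP.+-identityʳ _) (cong suc (trans (choose-1 x) (sym (ℕP.*-identityʳ x)))))
choose-absorption (suc x) (suc k) = begin
  suc (suc k) ℕ.* (b₁ ℕ.+ b₂)
    ≡⟨ N.solve 3 (λ k a b → (N.con 2 N.:+ k) N.:* (a N.:+ b)
                            N.:= a N.:+ (N.con 1 N.:+ k) N.:* a N.:+ (N.con 2 N.:+ k) N.:* b) refl k b₁ b₂ ⟩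
  b₁ ℕ.+ suc k ℕ.* b₁ ℕ.+ suc (suc k) ℕ.* b₂
    ≡⟨ cong₂ (λ s t → b₁ ℕ.+ s ℕ.+ t) (choose-absorption x k) (choose-absorption x (suc k)) ⟩
  b₁ ℕ.+ suc x ℕ.* a₁ ℕ.+ suc x ℕ.* a₂
    ≡⟨ N.solve 3 (λ x a b → (a N.:+ b) N.:+ (N.con 1 N.:+ x) N.:* a N.:+ (N.con 1 N.:+ x) N.:* b
                            N.:= (N.con 2 N.:+ x) N.:* (a N.:+ b)) refl x a₁ a₂ ⟩
  suc (suc x) ℕ.* (suc x choose suc k) ∎
  where
  module N = ℕSolver.+-*-Solver
  a₁ = x choose k
  a₂ = x choose suc k
  b₁ = suc x choose suc k
  b₂ = suc x choose suc (suc k)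

*-choose : ∀ x i → x ℕ.* (x choose i) ≡ i ℕ.* (x choose i) ℕ.+ suc i ℕ.* (x choose suc i)
*-choose zero    zero    = refl
*-choose zero    (suc i) = sym (cong₂ ℕ._+_ (ℕP.*-zeroʳ (suc i)) (ℕP.*-zeroʳ (suc (suc i))))
*-choose (suc x) zero    =
  trans (ℕP.*-identityʳ (suc x)) (cong suc (sym (trans (ℕP.+-identityʳ _) (choose-1 x))))
*-choose (suc x) (suc i) = begin
  suc x ℕ.* (x choose i ℕ.+ x choose suc i)
    ≡⟨ ℕP.*-distribˡ-+ (suc x) (x choose i) (x choose suc i) ⟩
  suc x ℕ.* (x choose i) ℕ.+ suc x ℕ.* (x choose suc i)
    ≡⟨ cong₂ ℕ._+_ (choose-absorption x i) (choose-absorption x (suc i)) ⟨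
  suc i ℕ.* (suc x choose suc i) ℕ.+ suc (suc i) ℕ.* (suc x choose suc (suc i)) ∎

hockey-stick : ∀ M j → Σ< M (λ x → ι (x choose j)) ≡ ι (M choose suc j)
hockey-stick zero    j = refl
hockey-stick (suc M) j = begin
  Σ< M (λ x → ι (x choose j)) + ι (M choose j)   ≡⟨ cong (_+ ι (M choose j)) (hockey-stick M j) ⟩
  ι (M choose suc j) + ι (M choose j)            ≡⟨ ℚP.+-comm (ι (M choose suc j)) (ι (M choose j)) ⟩
  ι (M choose j) + ι (M choose suc j)            ≡⟨ ι-+ (M choose j) (M choose suc j) ⟨
  ι (suc M choose suc j)                         ∎

ι*ι-choose : ∀ x j → ι x * ι (x choose j) ≡ ι j * ι (x choose j) + ι (suc j) * ι (x choose suc j)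
ι*ι-choose x j = begin
  ι x * ι (x choose j)                                   ≡⟨ ι-* x (x choose j) ⟨
  ι (x ℕ.* (x choose j))                                 ≡⟨ cong ι (*-choose x j) ⟩
  ι (j ℕ.* (x choose j) ℕ.+ suc j ℕ.* (x choose suc j))  ≡⟨ ι-+ (j ℕ.* (x choose j)) (suc j ℕ.* (x choose suc j)) ⟩
  ι (j ℕ.* (x choose j)) + ι (suc j ℕ.* (x choose suc j))
    ≡⟨ cong₂ _+_ (ι-* j (x choose j)) (ι-* (suc j) (x choose suc j)) ⟩
  ι j * ι (x choose j) + ι (suc j) * ι (x choose suc j)  ∎

-- Polynomials in the Mahler basis

-- A polynomial is represented by its integer coefficients in the basis x ↦ x choose j;
-- lincomb v i pairs the coefficient list with the values v i, v (i + 1), …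
Mahler : Set
Mahler = List ℤ

lincomb : (ℕ → ℚ) → ℕ → Mahler → ℚ
lincomb v i []       = 0ℚ
lincomb v i (c ∷ cs) = ιℤ c * v i + lincomb v (suc i) cs

eval : Mahler → ℕ → ℚ
eval cs x = lincomb (λ j → ι (x choose j)) 0 cs

∫C : ℕ → ℚ
∫C j = sgn j * 1/[1+ j ]

integral : Mahler → ℚ
integral = lincomb ∫C 0

lincomb-cong : ∀ {u v} → (∀ j → u j ≡ v j) → ∀ i cs → lincomb u i cs ≡ lincomb v i cs
lincomb-cong u≗v i []       = refl
lincomb-cong u≗v i (c ∷ cs) = cong₂ (λ s t → ιℤ c * s + t) (u≗v i) (lincomb-cong u≗v (suc i) cs)

lincomb-shift : ∀ v i cs → lincomb v (suc i) cs ≡ lincomb (λ j → v (suc j)) i cs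
lincomb-shift v i []       = refl
lincomb-shift v i (c ∷ cs) = cong (λ s → ιℤ c * v (suc i) + s) (lincomb-shift v (suc i) cs)

lincomb-zero : ∀ i cs → lincomb (λ _ → 0ℚ) i cs ≡ 0ℚ
lincomb-zero i []       = refl
lincomb-zero i (c ∷ cs) = cong₂ _+_ (ℚP.*-zeroʳ (ιℤ c)) (lincomb-zero (suc i) cs)

lincomb-+ : ∀ u v i cs → lincomb (λ j → u j + v j) i cs ≡ lincomb u i cs + lincomb v i cs
lincomb-+ u v i []       = refl
lincomb-+ u v i (c ∷ cs) = begin
  ιℤ c * (u i + v i) + lincomb (λ j → u j + v j) (suc i) cs
    ≡⟨ cong (λ s → ιℤ c * (u i + v i) + s) (lincomb-+ u v (suc i) cs) ⟩
  ιℤ c * (u i + v i) + (U + V)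
    ≡⟨ solve 5 (λ c a b s t → c :* (a :+ b) :+ (s :+ t) := (c :* a :+ s) :+ (c :* b :+ t)) refl (ιℤ c) (u i) (v i) U V ⟩
  (ιℤ c * u i + U) + (ιℤ c * v i + V) ∎
  where
  U = lincomb u (suc i) cs
  V = lincomb v (suc i) cs

lincomb-* : ∀ a v i cs → lincomb (λ j → a * v j) i cs ≡ a * lincomb v i cs
lincomb-* a v i []       = sym (ℚP.*-zeroʳ a)
lincomb-* a v i (c ∷ cs) = begin
  ιℤ c * (a * v i) + lincomb (λ j → a * v j) (suc i) cs ≡⟨ cong (λ s → ιℤ c * (a * v i) + s) (lincomb-* a v (suc i) cs) ⟩
  ιℤ c * (a * v i) + a * V
    ≡⟨ solve 4 (λ c a b s → c :* (a :* b) :+ a :* s := a :* (c :* b :+ s)) refl (ιℤ c) a (v i) V ⟩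
  a * (ιℤ c * v i + V) ∎
  where V = lincomb v (suc i) cs

lincomb-Σ< : ∀ M (v : ℕ → ℕ → ℚ) i cs →
             Σ< M (λ x → lincomb (v x) i cs) ≡ lincomb (λ j → Σ< M (λ x → v x j)) i cs
lincomb-Σ< zero    v i cs = sym (lincomb-zero i cs)
lincomb-Σ< (suc M) v i cs = begin
  Σ< M (λ x → lincomb (v x) i cs) + lincomb (v M) i cs
    ≡⟨ cong (_+ lincomb (v M) i cs) (lincomb-Σ< M v i cs) ⟩
  lincomb (λ j → Σ< M (λ x → v x j)) i cs + lincomb (v M) i cs
    ≡⟨ lincomb-+ (λ j → Σ< M (λ x → v x j)) (v M) i cs ⟨
  lincomb (λ j → Σ< (suc M) (λ x → v x j)) i cs ∎

infixl 6 _+ᴹ_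
infixl 7 _·ᴹ_

_+ᴹ_ : Mahler → Mahler → Mahler
[]       +ᴹ bs       = bs
(a ∷ as) +ᴹ []       = a ∷ as
(a ∷ as) +ᴹ (b ∷ bs) = (a ℤ.+ b) ∷ (as +ᴹ bs)

_·ᴹ_ : ℤ → Mahler → Mahler
z ·ᴹ []       = []
z ·ᴹ (c ∷ cs) = (z ℤ.* c) ∷ (z ·ᴹ cs)

Σᴹ< : ℕ → (ℕ → Mahler) → Mahler
Σᴹ< zero    F = []
Σᴹ< (suc n) F = Σᴹ< n F +ᴹ F n

lincomb-+ᴹ : ∀ v i as bs → lincomb v i (as +ᴹ bs) ≡ lincomb v i as + lincomb v i bs
lincomb-+ᴹ v i []       bs       = sym (ℚP.+-identityˡ _)
lincomb-+ᴹ v i (a ∷ as) []       = sym (ℚP.+-identityʳ _)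
lincomb-+ᴹ v i (a ∷ as) (b ∷ bs) = begin
  ιℤ (a ℤ.+ b) * v i + lincomb v (suc i) (as +ᴹ bs)
    ≡⟨ cong₂ (λ s t → s * v i + t) (ιℤ-+ a b) (lincomb-+ᴹ v (suc i) as bs) ⟩
  (ιℤ a + ιℤ b) * v i + (A + B)
    ≡⟨ solve 5 (λ a b x s t → (a :+ b) :* x :+ (s :+ t) := (a :* x :+ s) :+ (b :* x :+ t)) refl (ιℤ a) (ιℤ b) (v i) A B ⟩
  (ιℤ a * v i + A) + (ιℤ b * v i + B) ∎
  where
  A = lincomb v (suc i) as
  B = lincomb v (suc i) bs

lincomb-·ᴹ : ∀ v i z cs → lincomb v i (z ·ᴹ cs) ≡ ιℤ z * lincomb v i cs
lincomb-·ᴹ v i z []       = sym (ℚP.*-zeroʳ (ιℤ z))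
lincomb-·ᴹ v i z (c ∷ cs) = begin
  ιℤ (z ℤ.* c) * v i + lincomb v (suc i) (z ·ᴹ cs)
    ≡⟨ cong₂ (λ s t → s * v i + t) (ιℤ-* z c) (lincomb-·ᴹ v (suc i) z cs) ⟩
  ιℤ z * ιℤ c * v i + ιℤ z * V
    ≡⟨ solve 4 (λ z c x s → z :* c :* x :+ z :* s := z :* (c :* x :+ s)) refl (ιℤ z) (ιℤ c) (v i) V ⟩
  ιℤ z * (ιℤ c * v i + V) ∎
  where V = lincomb v (suc i) cs

lincomb-Σᴹ< : ∀ v i n F → lincomb v i (Σᴹ< n F) ≡ Σ< n (λ k → lincomb v i (F k))
lincomb-Σᴹ< v i zero    F = refl
lincomb-Σᴹ< v i (suc n) F =
  trans (lincomb-+ᴹ v i (Σᴹ< n F) (F n)) (cong (_+ lincomb v i (F n)) (lincomb-Σᴹ< v i n F))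

-- Since x · (x choose j) = j · (x choose j) + (j + 1) · (x choose (j + 1)), the coefficient of
-- x choose j in x · P is j · (cⱼ + cⱼ₋₁); the second argument carries cⱼ₋₁.
X*ᴹ-from : ℕ → ℤ → Mahler → Mahler
X*ᴹ-from j previous []       = (+ j ℤ.* previous) ∷ []
X*ᴹ-from j previous (c ∷ cs) = (+ j ℤ.* c ℤ.+ + j ℤ.* previous) ∷ X*ᴹ-from (suc j) c cs

X*ᴹ_ : Mahler → Mahler
X*ᴹ cs = X*ᴹ-from 0 (+ 0) cs

module _ (x : ℕ) where
  private
    χ : ℕ → ℚ
    χ j = ι (x choose j)

  lincomb-X*ᴹ-from : ∀ j previous cs →
    lincomb χ j (X*ᴹ-from j previous cs) ≡ ι x * lincomb χ j cs + ι j * ιℤ previous * χ j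
  lincomb-X*ᴹ-from j previous [] = begin
    ιℤ (+ j ℤ.* previous) * χ j + 0ℚ     ≡⟨ cong (λ s → s * χ j + 0ℚ) (ιℤ-* (+ j) previous) ⟩
    ι j * ιℤ previous * χ j + 0ℚ         ≡⟨ solve 2 (λ y a → a :+ con 0ℚ := y :* con 0ℚ :+ a) refl (ι x) (ι j * ιℤ previous * χ j) ⟩
    ι x * 0ℚ + ι j * ιℤ previous * χ j   ∎
  lincomb-X*ᴹ-from j previous (c ∷ cs) = begin
    ιℤ (+ j ℤ.* c ℤ.+ + j ℤ.* previous) * χ j + lincomb χ (suc j) (X*ᴹ-from (suc j) c cs)
      ≡⟨ cong₂ (λ s t → s * χ j + t) coefficient (lincomb-X*ᴹ-from (suc j) c cs) ⟩
    (ι j * ιℤ c + ι j * ιℤ previous) * χ j + (ι x * L + ι (suc j) * ιℤ c * χ (suc j))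
      ≡⟨ solve 8 (λ J c p χ y L J′ χ′ → (J :* c :+ J :* p) :* χ :+ (y :* L :+ J′ :* c :* χ′)
                                        := c :* (J :* χ :+ J′ :* χ′) :+ y :* L :+ J :* p :* χ)
               refl (ι j) (ιℤ c) (ιℤ previous) (χ j) (ι x) L (ι (suc j)) (χ (suc j)) ⟩
    ιℤ c * (ι j * χ j + ι (suc j) * χ (suc j)) + ι x * L + P
      ≡⟨ cong (λ s → ιℤ c * s + ι x * L + P) (ι*ι-choose x j) ⟨
    ιℤ c * (ι x * χ j) + ι x * L + P
      ≡⟨ solve 5 (λ c y χ L P → c :* (y :* χ) :+ y :* L :+ P := y :* (c :* χ :+ L) :+ P) refl (ιℤ c) (ι x) (χ j) L P ⟩
    ι x * (ιℤ c * χ j + L) + P ∎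
    where
    L = lincomb χ (suc j) cs
    P = ι j * ιℤ previous * χ j
    coefficient : ιℤ (+ j ℤ.* c ℤ.+ + j ℤ.* previous) ≡ ι j * ιℤ c + ι j * ιℤ previous
    coefficient = trans (ιℤ-+ (+ j ℤ.* c) _) (cong₂ _+_ (ιℤ-* (+ j) c) (ιℤ-* (+ j) previous))

  eval-X*ᴹ : ∀ cs → eval (X*ᴹ cs) x ≡ ι x * eval cs x
  eval-X*ᴹ cs = trans (lincomb-X*ᴹ-from 0 (+ 0) cs)
                      (solve 2 (λ a b → a :+ con 0ℚ :* b := a) refl (ι x * eval cs x) (χ 0))

eval-∷-zero : ∀ c cs → eval (c ∷ cs) 0 ≡ ιℤ c
eval-∷-zero c cs = begin
  ιℤ c * 1ℚ + lincomb (λ j → ι (0 choose j)) 1 cs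
    ≡⟨ cong (λ s → ιℤ c * 1ℚ + s) (trans (lincomb-shift _ 0 cs) (lincomb-zero 0 cs)) ⟩
  ιℤ c * 1ℚ + 0ℚ  ≡⟨ solve 1 (λ c → c :* con 1ℚ :+ con 0ℚ := c) refl (ιℤ c) ⟩
  ιℤ c            ∎

eval-∷-suc : ∀ c cs x → eval (c ∷ cs) (suc x) ≡ eval (c ∷ cs) x + eval cs x
eval-∷-suc c cs x = begin
  ιℤ c * 1ℚ + lincomb (λ j → ι (suc x choose j)) 1 cs   ≡⟨ cong (λ s → ιℤ c * 1ℚ + s) pascal ⟩
  ιℤ c * 1ℚ + (eval cs x + lincomb χ 1 cs)
    ≡⟨ solve 3 (λ a e l → a :+ (e :+ l) := (a :+ l) :+ e) refl (ιℤ c * 1ℚ) (eval cs x) (lincomb χ 1 cs) ⟩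
  ιℤ c * 1ℚ + lincomb χ 1 cs + eval cs x                ∎
  where
  χ : ℕ → ℚ
  χ j = ι (x choose j)
  pascal : lincomb (λ j → ι (suc x choose j)) 1 cs ≡ eval cs x + lincomb χ 1 cs
  pascal = begin
    lincomb (λ j → ι (suc x choose j)) 1 cs       ≡⟨ lincomb-shift _ 0 cs ⟩
    lincomb (λ j → ι (suc x choose suc j)) 0 cs   ≡⟨ lincomb-cong (λ j → ι-+ (x choose j) (x choose suc j)) 0 cs ⟩
    lincomb (λ j → χ j + χ (suc j)) 0 cs          ≡⟨ lincomb-+ χ (λ j → χ (suc j)) 0 cs ⟩
    eval cs x + lincomb (λ j → χ (suc j)) 0 cs    ≡⟨ cong (λ s → eval cs x + s) (lincomb-shift χ 0 cs) ⟨
    eval cs x + lincomb χ 1 cs                    ∎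

eval≡0⇒lincomb≡0 : ∀ cs → (∀ x → eval cs x ≡ 0ℚ) → ∀ v i → lincomb v i cs ≡ 0ℚ
eval≡0⇒lincomb≡0 []       eval≡0 v i = refl
eval≡0⇒lincomb≡0 (c ∷ cs) eval≡0 v i = begin
  ιℤ c * v i + lincomb v (suc i) cs   ≡⟨ cong₂ (λ s t → s * v i + t) c≡0 (eval≡0⇒lincomb≡0 cs tail≡0 v (suc i)) ⟩
  0ℚ * v i + 0ℚ                       ≡⟨ solve 1 (λ a → con 0ℚ :* a :+ con 0ℚ := con 0ℚ) refl (v i) ⟩
  0ℚ                                  ∎
  where
  c≡0 : ιℤ c ≡ 0ℚ
  c≡0 = trans (sym (eval-∷-zero c cs)) (eval≡0 0)
  tail≡0 : ∀ x → eval cs x ≡ 0ℚ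
  tail≡0 x = begin
    eval cs x                     ≡⟨ ℚP.+-identityˡ (eval cs x) ⟨
    0ℚ + eval cs x                ≡⟨ cong (_+ eval cs x) (eval≡0 x) ⟨
    eval (c ∷ cs) x + eval cs x   ≡⟨ eval-∷-suc c cs x ⟨
    eval (c ∷ cs) (suc x)         ≡⟨ eval≡0 (suc x) ⟩
    0ℚ                            ∎

integral-cong : ∀ as bs → (∀ x → eval as x ≡ eval bs x) → integral as ≡ integral bs
integral-cong as bs as≗bs = begin
  integral as
    ≡⟨ solve 2 (λ a b → a := (a :+ con (- 1ℚ) :* b) :+ b) refl (integral as) (integral bs) ⟩
  (integral as + - 1ℚ * integral bs) + integral bs   ≡⟨ cong (_+ integral bs) (linear ∫C) ⟨
  integral difference + integral bs                  ≡⟨ cong (_+ integral bs) (eval≡0⇒lincomb≡0 difference difference≡0 ∫C 0) ⟩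
  0ℚ + integral bs                                   ≡⟨ ℚP.+-identityˡ (integral bs) ⟩
  integral bs                                        ∎
  where
  difference : Mahler
  difference = as +ᴹ ℤ.-1ℤ ·ᴹ bs
  linear : ∀ v → lincomb v 0 difference ≡ lincomb v 0 as + - 1ℚ * lincomb v 0 bs
  linear v = trans (lincomb-+ᴹ v 0 as (ℤ.-1ℤ ·ᴹ bs)) (cong (λ s → lincomb v 0 as + s) (lincomb-·ᴹ v 0 ℤ.-1ℤ bs))
  difference≡0 : ∀ x → eval difference x ≡ 0ℚ
  difference≡0 x = begin
    eval difference x              ≡⟨ linear (λ j → ι (x choose j)) ⟩
    eval as x + - 1ℚ * eval bs x   ≡⟨ cong (λ s → s + - 1ℚ * eval bs x) (as≗bs x) ⟩
    eval bs x + - 1ℚ * eval bs x   ≡⟨ solve 1 (λ b → b :+ con (- 1ℚ) :* b := con 0ℚ) refl (eval bs x) ⟩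
    0ℚ                             ∎

Xᴹ^ : ℕ → Mahler
Xᴹ^ zero    = + 1 ∷ []
Xᴹ^ (suc r) = X*ᴹ (Xᴹ^ r)

eval-Xᴹ^ : ∀ r x → eval (Xᴹ^ r) x ≡ ι x ^ℚ r
eval-Xᴹ^ zero    x = refl
eval-Xᴹ^ (suc r) x = trans (eval-X*ᴹ x (Xᴹ^ r)) (cong (ι x *_) (eval-Xᴹ^ r x))

coeff : Mahler → ℕ → ℤ
coeff []       j       = + 0
coeff (c ∷ cs) zero    = c
coeff (c ∷ cs) (suc j) = coeff cs j

lincomb-coeff : ∀ v cs → lincomb v 0 cs ≡ Σ< (length cs) (λ j → ιℤ (coeff cs j) * v j)
lincomb-coeff v []       = refl
lincomb-coeff v (c ∷ cs) = begin
  ιℤ c * v 0 + lincomb v 1 cs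
    ≡⟨ cong (λ s → ιℤ c * v 0 + s) (lincomb-shift v 0 cs) ⟩
  ιℤ c * v 0 + lincomb (λ j → v (suc j)) 0 cs
    ≡⟨ cong (λ s → ιℤ c * v 0 + s) (lincomb-coeff (λ j → v (suc j)) cs) ⟩
  ιℤ c * v 0 + Σ< (length cs) (λ j → ιℤ (coeff cs j) * v (suc j))
    ≡⟨ Σ<-sucˡ (length cs) (λ j → ιℤ (coeff (c ∷ cs) j) * v j) ⟨
  Σ< (suc (length cs)) (λ j → ιℤ (coeff (c ∷ cs) j) * v j) ∎

length-X*ᴹ-from : ∀ i previous cs → length (X*ᴹ-from i previous cs) ≡ suc (length cs)
length-X*ᴹ-from i previous []       = refl
length-X*ᴹ-from i previous (c ∷ cs) = cong suc (length-X*ᴹ-from (suc i) c cs)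

length-Xᴹ^ : ∀ r → length (Xᴹ^ r) ≡ suc r
length-Xᴹ^ zero    = refl
length-Xᴹ^ (suc r) = trans (length-X*ᴹ-from 0 (+ 0) (Xᴹ^ r)) (cong suc (length-Xᴹ^ r))

coeff-X*ᴹ-from : ∀ i previous cs j →
  coeff (X*ᴹ-from i previous cs) j ≡ + (i ℕ.+ j) ℤ.* coeff cs j ℤ.+ + (i ℕ.+ j) ℤ.* coeff (previous ∷ cs) j
coeff-X*ᴹ-from i previous [] zero
  rewrite ℕP.+-identityʳ i | ℤP.*-zeroʳ (+ i) = sym (ℤP.+-identityˡ (+ i ℤ.* previous))
coeff-X*ᴹ-from i previous [] (suc j)
  rewrite ℤP.*-zeroʳ (+ (i ℕ.+ suc j)) = refl
coeff-X*ᴹ-from i previous (c ∷ cs) zero =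
  cong (λ k → + k ℤ.* c ℤ.+ + k ℤ.* previous) (sym (ℕP.+-identityʳ i))
coeff-X*ᴹ-from i previous (c ∷ cs) (suc j) =
  trans (coeff-X*ᴹ-from (suc i) c cs j)
        (cong (λ k → + k ℤ.* coeff cs j ℤ.+ + k ℤ.* coeff (c ∷ cs) j) (sym (ℕP.+-suc i j)))

-- m! S₂ r m obeys the coefficient recurrence of X*ᴹ-from:
-- m! S₂ (r + 1) m = m · (m! S₂ r m + (m - 1)! S₂ r (m - 1)).
coeff-Xᴹ^ : ∀ r m → coeff (Xᴹ^ r) m ≡ + (m ! ℕ.* S₂ r m)
coeff-Xᴹ^ zero    zero    = refl
coeff-Xᴹ^ zero    (suc m) = cong +_ (sym (ℕP.*-zeroʳ (suc m !)))
coeff-Xᴹ^ (suc r) zero    =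
  trans (coeff-X*ᴹ-from 0 (+ 0) (Xᴹ^ r) 0) (cong (ℤ._+ + 0) (ℤP.*-zeroˡ (coeff (Xᴹ^ r) 0)))
coeff-Xᴹ^ (suc r) (suc m) = begin
  coeff (Xᴹ^ (suc r)) (suc m)
    ≡⟨ coeff-X*ᴹ-from 0 (+ 0) (Xᴹ^ r) (suc m) ⟩
  + suc m ℤ.* coeff (Xᴹ^ r) (suc m) ℤ.+ + suc m ℤ.* coeff (Xᴹ^ r) m
    ≡⟨ cong₂ (λ s t → + suc m ℤ.* s ℤ.+ + suc m ℤ.* t) (coeff-Xᴹ^ r (suc m)) (coeff-Xᴹ^ r m) ⟩
  + suc m ℤ.* + a ℤ.+ + suc m ℤ.* + b
    ≡⟨ cong₂ ℤ._+_ (ℤP.pos-* (suc m) a) (ℤP.pos-* (suc m) b) ⟨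
  + (suc m ℕ.* a) ℤ.+ + (suc m ℕ.* b)
    ≡⟨ ℤP.pos-+ (suc m ℕ.* a) (suc m ℕ.* b) ⟨
  + (suc m ℕ.* a ℕ.+ suc m ℕ.* b)
    ≡⟨ cong +_ (N.solve 4 (λ m f s t → m N.:* ((m N.:* f) N.:* s) N.:+ m N.:* (f N.:* t)
                                      N.:= (m N.:* f) N.:* (m N.:* s N.:+ t)) refl (suc m) (m !) (S₂ r (suc m)) (S₂ r m)) ⟩
  + (suc m ! ℕ.* S₂ (suc r) (suc m)) ∎
  where
  module N = ℕSolver.+-*-Solver
  a = suc m ! ℕ.* S₂ r (suc m)
  b = m ! ℕ.* S₂ r m

integral-Xᴹ^ : ∀ r → integral (Xᴹ^ r) ≡ Σ≤ r (λ m → sgn m * ι (S₂ r m) * (+ (m !) / suc m))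
integral-Xᴹ^ r = begin
  integral (Xᴹ^ r)                                      ≡⟨ lincomb-coeff ∫C (Xᴹ^ r) ⟩
  Σ< (length (Xᴹ^ r)) t                                 ≡⟨ cong (λ n → Σ< n t) (length-Xᴹ^ r) ⟩
  Σ≤ r t                                                ≡⟨ Σ<-cong (suc r) term ⟩
  Σ≤ r (λ m → sgn m * ι (S₂ r m) * (+ (m !) / suc m))   ∎
  where
  t : ℕ → ℚ
  t m = ιℤ (coeff (Xᴹ^ r) m) * ∫C m
  term : ∀ m → t m ≡ sgn m * ι (S₂ r m) * (+ (m !) / suc m)
  term m = begin
    ιℤ (coeff (Xᴹ^ r) m) * ∫C m                 ≡⟨ cong (λ z → ιℤ z * ∫C m) (coeff-Xᴹ^ r m) ⟩
    ι (m ! ℕ.* S₂ r m) * (sgn m * 1/[1+ m ])     ≡⟨ cong (_* (sgn m * 1/[1+ m ])) (ι-* (m !) (S₂ r m)) ⟩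
    ι (m !) * ι (S₂ r m) * (sgn m * 1/[1+ m ])
      ≡⟨ solve 4 (λ f s σ u → f :* s :* (σ :* u) := σ :* s :* (f :* u)) refl (ι (m !)) (ι (S₂ r m)) (sgn m) 1/[1+ m ] ⟩
    sgn m * ι (S₂ r m) * (ι (m !) * 1/[1+ m ])   ≡⟨ cong (sgn m * ι (S₂ r m) *_) (/suc≡*1/[1+_] (m !) m) ⟨
    sgn m * ι (S₂ r m) * (+ (m !) / suc m)      ∎

1-X*ᴹ_ : Mahler → Mahler
1-X*ᴹ cs = cs +ᴹ ℤ.-1ℤ ·ᴹ X*ᴹ cs

eval-1-X*ᴹ : ∀ cs x → eval (1-X*ᴹ cs) x ≡ (1ℚ - ι x) * eval cs x
eval-1-X*ᴹ cs x = begin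
  eval (1-X*ᴹ cs) x                      ≡⟨ lincomb-+ᴹ _ 0 cs (ℤ.-1ℤ ·ᴹ X*ᴹ cs) ⟩
  eval cs x + eval (ℤ.-1ℤ ·ᴹ X*ᴹ cs) x    ≡⟨ cong (λ s → eval cs x + s) (lincomb-·ᴹ _ 0 ℤ.-1ℤ (X*ᴹ cs)) ⟩
  eval cs x + - 1ℚ * eval (X*ᴹ cs) x     ≡⟨ cong (λ s → eval cs x + - 1ℚ * s) (eval-X*ᴹ x cs) ⟩
  eval cs x + - 1ℚ * (ι x * eval cs x)
    ≡⟨ solve 2 (λ e y → e :+ con (- 1ℚ) :* (y :* e) := (con 1ℚ :- y) :* e) refl (eval cs x) (ι x) ⟩
  (1ℚ - ι x) * eval cs x                 ∎

xᵏ[1-x]ʲ : ℕ → ℕ → Mahler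
xᵏ[1-x]ʲ k zero    = Xᴹ^ k
xᵏ[1-x]ʲ k (suc j) = 1-X*ᴹ xᵏ[1-x]ʲ k j

eval-xᵏ[1-x]ʲ : ∀ k j x → eval (xᵏ[1-x]ʲ k j) x ≡ ι x ^ℚ k * (1ℚ - ι x) ^ℚ j
eval-xᵏ[1-x]ʲ k zero    x = trans (eval-Xᴹ^ k x) (sym (ℚP.*-identityʳ _))
eval-xᵏ[1-x]ʲ k (suc j) x = begin
  eval (1-X*ᴹ xᵏ[1-x]ʲ k j) x                 ≡⟨ eval-1-X*ᴹ (xᵏ[1-x]ʲ k j) x ⟩
  (1ℚ - ι x) * eval (xᵏ[1-x]ʲ k j) x          ≡⟨ cong ((1ℚ - ι x) *_) (eval-xᵏ[1-x]ʲ k j x) ⟩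
  (1ℚ - ι x) * (ι x ^ℚ k * (1ℚ - ι x) ^ℚ j)
    ≡⟨ solve 3 (λ y a b → y :* (a :* b) := a :* (y :* b)) refl (1ℚ - ι x) (ι x ^ℚ k) ((1ℚ - ι x) ^ℚ j) ⟩
  ι x ^ℚ k * (1ℚ - ι x) ^ℚ suc j              ∎

bernsteinᴹ : ℕ → ℕ → Mahler
bernsteinᴹ k n = + (n C k) ·ᴹ xᵏ[1-x]ʲ k (n ∸ k)

eval-bernsteinᴹ : ∀ k n x → eval (bernsteinᴹ k n) x ≡ bernstein k n (ι x)
eval-bernsteinᴹ k n x = begin
  eval (bernsteinᴹ k n) x                          ≡⟨ lincomb-·ᴹ _ 0 (+ (n C k)) (xᵏ[1-x]ʲ k (n ∸ k)) ⟩
  ι (n C k) * eval (xᵏ[1-x]ʲ k (n ∸ k)) x          ≡⟨ cong (ι (n C k) *_) (eval-xᵏ[1-x]ʲ k (n ∸ k) x) ⟩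
  ι (n C k) * (ι x ^ℚ k * (1ℚ - ι x) ^ℚ (n ∸ k))   ≡⟨ ℚP.*-assoc (ι (n C k)) _ _ ⟨
  bernstein k n (ι x)                              ∎

-- Bounded denominators

ι[1+j]*∫C : ∀ j → ι (suc j) * ∫C j ≡ sgn j
ι[1+j]*∫C j = begin
  ι (suc j) * (sgn j * 1/[1+ j ])
    ≡⟨ solve 3 (λ J s u → J :* (s :* u) := s :* (u :* J)) refl (ι (suc j)) (sgn j) 1/[1+ j ] ⟩
  sgn j * (1/[1+ j ] * ι (suc j))   ≡⟨ cong (sgn j *_) (1/[1+m]*[1+m]≡1 j) ⟩
  sgn j * 1ℚ                        ≡⟨ ℚP.*-identityʳ (sgn j) ⟩
  sgn j                             ∎

binomRemainder : ℕ → ℕ → ℚ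
binomRemainder M zero    = 0ℚ
binomRemainder M (suc i) = 1/[1+ suc i ] * (∫C i + (ι M - ι (suc i)) * binomRemainder M i)

choose-expansion : ∀ M i → ι (M choose suc i) ≡ ι M * ∫C i + ι M * ι M * binomRemainder M i
choose-expansion M zero = begin
  ι (M choose 1)                ≡⟨ cong ι (choose-1 M) ⟩
  ι M                           ≡⟨ solve 1 (λ m → m := m :* con 1ℚ :+ m :* m :* con 0ℚ) refl (ι M) ⟩
  ι M * ∫C 0 + ι M * ι M * 0ℚ   ∎
choose-expansion M (suc i) = begin
  b₂                        ≡⟨ ℚP.*-identityˡ b₂ ⟨
  1ℚ * b₂                   ≡⟨ cong (_* b₂) (1/[1+m]*[1+m]≡1 (suc i)) ⟨
  u * k₂ * b₂               ≡⟨ ℚP.*-assoc u k₂ b₂ ⟩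
  u * (k₂ * b₂)             ≡⟨ cong (u *_) absorbed ⟩
  u * (m * b₁ - k₁ * b₁)    ≡⟨ cong (λ b → u * (m * b - k₁ * b)) (choose-expansion M i) ⟩
  u * (m * (m * w + m * m * R) - k₁ * (m * w + m * m * R))
    ≡⟨ solve 5 (λ u m k w R → u :* (m :* (m :* w :+ m :* m :* R) :- k :* (m :* w :+ m :* m :* R))
                              := m :* (u :* (:- (k :* w))) :+ m :* m :* (u :* (w :+ (m :- k) :* R)))
             refl u m k₁ w R ⟩
  m * (u * - (k₁ * w)) + m * m * R′   ≡⟨ cong (λ s → m * (u * - s) + m * m * R′) (ι[1+j]*∫C i) ⟩
  m * (u * - sgn i) + m * m * R′
    ≡⟨ cong (λ s → m * s + m * m * R′) (solve 2 (λ u s → u :* (:- s) := (con (- 1ℚ) :* s) :* u) refl u (sgn i)) ⟩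
  m * ∫C (suc i) + m * m * R′         ∎
  where
  m = ι M
  k₁ = ι (suc i)
  k₂ = ι (suc (suc i))
  u = 1/[1+ suc i ]
  w = ∫C i
  R = binomRemainder M i
  R′ = binomRemainder M (suc i)
  b₁ = ι (M choose suc i)
  b₂ = ι (M choose suc (suc i))
  absorbed : k₂ * b₂ ≡ m * b₁ - k₁ * b₁
  absorbed = begin
    k₂ * b₂                         ≡⟨ solve 2 (λ a b → a := (b :+ a) :- b) refl (k₂ * b₂) (k₁ * b₁) ⟩
    (k₁ * b₁ + k₂ * b₂) - k₁ * b₁   ≡⟨ cong (_- k₁ * b₁) (ι*ι-choose M (suc i)) ⟨
    m * b₁ - k₁ * b₁                ∎

-- Indexed by d rather than by the clearing factor d + 1, which is thus never 0.
record Cleared (d : ℕ) (q : ℚ) : Set where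
  constructor cleared
  field
    numerator : ℤ
    clears    : q * ι (suc d) ≡ ιℤ numerator

infixl 7 _⊗_

_⊗_ : ℕ → ℕ → ℕ
a ⊗ b = ℕ.pred (suc a ℕ.* suc b)

cleared-ιℤ : ∀ z → Cleared 0 (ιℤ z)
cleared-ιℤ z = cleared z (ℚP.*-identityʳ (ιℤ z))

cleared-1/[1+_] : ∀ k → Cleared k 1/[1+ k ]
cleared-1/[1+ k ] = cleared (+ 1) (1/[1+m]*[1+m]≡1 k)

cleared-neg : ∀ {d q} → Cleared d q → Cleared d (- q)
cleared-neg {d} {q} (cleared z q*d) = cleared (ℤ.- z) (begin
  - q * ι (suc d)     ≡⟨ ℚP.neg-distribˡ-* q (ι (suc d)) ⟨
  - (q * ι (suc d))   ≡⟨ cong -_ q*d ⟩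
  - ιℤ z              ≡⟨ ιℤ-neg z ⟨
  ιℤ (ℤ.- z)          ∎)

cleared-+ : ∀ {a b q r} → Cleared a q → Cleared b r → Cleared (a ⊗ b) (q + r)
cleared-+ {a} {b} {q} {r} (cleared y q*a) (cleared z r*b) = cleared (y ℤ.* + suc b ℤ.+ z ℤ.* + suc a) (begin
  (q + r) * ι (suc a ℕ.* suc b)           ≡⟨ cong ((q + r) *_) (ι-* (suc a) (suc b)) ⟩
  (q + r) * (ι (suc a) * ι (suc b))
    ≡⟨ solve 4 (λ q r A B → (q :+ r) :* (A :* B) := (q :* A) :* B :+ (r :* B) :* A) refl q r (ι (suc a)) (ι (suc b)) ⟩
  q * ι (suc a) * ι (suc b) + r * ι (suc b) * ι (suc a)
    ≡⟨ cong₂ (λ s t → s * ι (suc b) + t * ι (suc a)) q*a r*b ⟩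
  ιℤ y * ι (suc b) + ιℤ z * ι (suc a)     ≡⟨ cong₂ _+_ (ιℤ-* y (+ suc b)) (ιℤ-* z (+ suc a)) ⟨
  ιℤ (y ℤ.* + suc b) + ιℤ (z ℤ.* + suc a) ≡⟨ ιℤ-+ (y ℤ.* + suc b) (z ℤ.* + suc a) ⟨
  ιℤ (y ℤ.* + suc b ℤ.+ z ℤ.* + suc a)    ∎)

cleared-* : ∀ {a b q r} → Cleared a q → Cleared b r → Cleared (a ⊗ b) (q * r)
cleared-* {a} {b} {q} {r} (cleared y q*a) (cleared z r*b) = cleared (y ℤ.* z) (begin
  q * r * ι (suc a ℕ.* suc b)         ≡⟨ cong ((q * r) *_) (ι-* (suc a) (suc b)) ⟩
  q * r * (ι (suc a) * ι (suc b))
    ≡⟨ solve 4 (λ q r A B → (q :* r) :* (A :* B) := (q :* A) :* (r :* B)) refl q r (ι (suc a)) (ι (suc b)) ⟩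
  q * ι (suc a) * (r * ι (suc b))     ≡⟨ cong₂ _*_ q*a r*b ⟩
  ιℤ y * ιℤ z                         ≡⟨ ιℤ-* y z ⟨
  ιℤ (y ℤ.* z)                        ∎)

UniformlyCleared : (ℕ → ℚ) → Set
UniformlyCleared f = ∃[ d ] ∀ M → Cleared d (f M)

uniformly-const : ∀ {d q} → Cleared d q → UniformlyCleared (λ _ → q)
uniformly-const q-cleared = _ , λ _ → q-cleared

uniformly-ι : UniformlyCleared ι
uniformly-ι = 0 , λ M → cleared-ιℤ (+ M)

uniformly-+ : ∀ {f g} → UniformlyCleared f → UniformlyCleared g → UniformlyCleared (λ M → f M + g M)
uniformly-+ (a , f-cleared) (b , g-cleared) = a ⊗ b , λ M → cleared-+ (f-cleared M) (g-cleared M)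

uniformly-* : ∀ {f g} → UniformlyCleared f → UniformlyCleared g → UniformlyCleared (λ M → f M * g M)
uniformly-* (a , f-cleared) (b , g-cleared) = a ⊗ b , λ M → cleared-* (f-cleared M) (g-cleared M)

uniformly-binomRemainder : ∀ i → UniformlyCleared (λ M → binomRemainder M i)
uniformly-binomRemainder zero    = uniformly-const (cleared-ιℤ (+ 0))
uniformly-binomRemainder (suc i) =
  uniformly-* (uniformly-const cleared-1/[1+ suc i ])
    (uniformly-+ (uniformly-const ∫C-cleared)
      (uniformly-* (uniformly-+ uniformly-ι (uniformly-const (cleared-neg (cleared-ιℤ (+ suc i)))))
        (uniformly-binomRemainder i)))
  where
  ∫C-cleared : Cleared (0 ⊗ i) (∫C i)
  ∫C-cleared = cleared-* (subst (Cleared 0) (ιℤ-sgnℤ i) (cleared-ιℤ (sgnℤ i))) cleared-1/[1+ i ]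

uniformly-lincomb : ∀ {v : ℕ → ℕ → ℚ} → (∀ j → UniformlyCleared (λ M → v M j)) →
                    ∀ i cs → UniformlyCleared (λ M → lincomb (v M) i cs)
uniformly-lincomb v-cleared i []       = uniformly-const (cleared-ιℤ (+ 0))
uniformly-lincomb v-cleared i (c ∷ cs) =
  uniformly-+ (uniformly-* (uniformly-const (cleared-ιℤ c)) (v-cleared i))
              (uniformly-lincomb v-cleared (suc i) cs)

-- p-adic convergence

^-monoʳ-∣ : ∀ p {m n} → m ≤ n → p ℕ.^ m ∣ p ℕ.^ n
^-monoʳ-∣ p {m} {n} m≤n = divides (p ℕ.^ (n ∸ m)) (begin
  p ℕ.^ n                     ≡⟨ cong (p ℕ.^_) (ℕP.m+[n∸m]≡n m≤n) ⟨
  p ℕ.^ (m ℕ.+ (n ∸ m))       ≡⟨ ℕP.^-distribˡ-+-* p m (n ∸ m) ⟩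
  p ℕ.^ m ℕ.* p ℕ.^ (n ∸ m)   ≡⟨ ℕP.*-comm (p ℕ.^ m) _ ⟩
  p ℕ.^ (n ∸ m) ℕ.* p ℕ.^ m   ∎)

prime^∣*coprime⇒∣ : ∀ {p} → Prime p → ∀ N a d → ¬ p ∣ d → p ℕ.^ N ∣ a ℕ.* d → p ℕ.^ N ∣ a
prime^∣*coprime⇒∣ pp zero a d p∤d _ = 1∣ a
prime^∣*coprime⇒∣ {p} pp (suc N) a d p∤d p^N+1∣ad
  with euclidsLemma a d pp (∣-trans (m∣m*n (p ℕ.^ N)) p^N+1∣ad)
... | inj₂ p∣d               = ⊥-elim (p∤d p∣d)
... | inj₁ (divides a′ refl) = subst (p ℕ.* p ℕ.^ N ∣_) (ℕP.*-comm p a′) (*-monoʳ-∣ p p^N∣a′)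
  where
  instance _ = prime⇒nonZero pp
  p^N∣a′ : p ℕ.^ N ∣ a′
  p^N∣a′ = prime^∣*coprime⇒∣ pp N a′ d p∤d (*-cancelˡ-∣ p (subst (p ℕ.* p ℕ.^ N ∣_)
             (trans (cong (ℕ._* d) (ℕP.*-comm a′ p)) (ℕP.*-assoc p a′ d)) p^N+1∣ad))

-- The exponent of p in d ≠ 0 is at most d.
prime^∣*⇒∣ : ∀ {p} → Prime p → ∀ N a d → d ≢ 0 → p ℕ.^ N ∣ a ℕ.* d → p ℕ.^ (N ∸ d) ∣ a
prime^∣*⇒∣ {p} pp zero a d d≢0 _ = subst (λ k → p ℕ.^ k ∣ a) (sym (ℕP.0∸n≡0 d)) (1∣ a)
prime^∣*⇒∣ {p} pp (suc N) a d d≢0 p^N+1∣ad with p ∣? d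
... | no p∤d =
  ∣-trans (^-monoʳ-∣ p (ℕP.m∸n≤m (suc N) d)) (prime^∣*coprime⇒∣ pp (suc N) a d p∤d p^N+1∣ad)
... | yes (divides d′ refl) = ∣-trans (^-monoʳ-∣ p (ℕP.∸-monoʳ-≤ (suc N) d′<d)) p^[N∸d′]∣a
  where
  instance _ = prime⇒nonZero pp
  d′≢0 : d′ ≢ 0
  d′≢0 refl = d≢0 refl
  d′<d : d′ ℕ.< d′ ℕ.* p
  d′<d = subst (ℕ._< d′ ℕ.* p) (ℕP.*-identityʳ d′)
           (ℕP.*-monoʳ-< d′ {{ℕ.≢-nonZero d′≢0}} (ℕ.nonTrivial⇒n>1 p {{prime⇒nonTrivial pp}}))
  p^[N∸d′]∣a : p ℕ.^ (N ∸ d′) ∣ a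
  p^[N∸d′]∣a = prime^∣*⇒∣ pp N a d′ d′≢0 (*-cancelˡ-∣ p (subst (p ℕ.* p ℕ.^ N ∣_)
                 (trans (sym (ℕP.*-assoc a d′ p)) (ℕP.*-comm (a ℕ.* d′) p)) p^N+1∣ad))

p^N-multiple⇒convergesPAdic : ∀ {p} (pp : Prime p) {a : ℕ → ℚ} {L : ℚ} {r : ℕ → ℚ} →
  UniformlyCleared r → (∀ N → a N - L ≡ ι (p ℕ.^ N) * r N) → ConvergesPAdic p a L
p^N-multiple⇒convergesPAdic {p} pp {a} {L} {r} (d , r-cleared) error M = M ℕ.+ suc d , bound
  where
  bound : ∀ N → M ℕ.+ suc d ≤ N → p ℕ.^ M ∣ ℤ.∣ ↥ (a N - L) ∣
  bound N M+d≤N =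
    ∣-trans (^-monoʳ-∣ p (ℕP.m+n≤o⇒m≤o∸n M M+d≤N)) (prime^∣*⇒∣ pp N ℤ.∣ ↥ X ∣ (suc d) (λ ()) p^N∣X*d)
    where
    X = a N - L
    P = p ℕ.^ N
    open Cleared (r-cleared N)
    X*d : X * ι (suc d) ≡ ιℤ (+ P ℤ.* numerator)
    X*d = begin
      X * ι (suc d)             ≡⟨ cong (_* ι (suc d)) (error N) ⟩
      ι P * r N * ι (suc d)     ≡⟨ ℚP.*-assoc (ι P) (r N) (ι (suc d)) ⟩
      ι P * (r N * ι (suc d))   ≡⟨ cong (ι P *_) clears ⟩
      ι P * ιℤ numerator        ≡⟨ ιℤ-* (+ P) numerator ⟨
      ιℤ (+ P ℤ.* numerator)    ∎
    |X*d| : ℤ.∣ ↥ X ∣ ℕ.* suc d ≡ P ℕ.* ℤ.∣ numerator ∣ ℕ.* ℤ.∣ ↧ X ∣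
    |X*d| = begin
      ℤ.∣ ↥ X ∣ ℕ.* suc d                     ≡⟨ ℤP.abs-* (↥ X) (+ suc d) ⟨
      ℤ.∣ ↥ X ℤ.* + suc d ∣                   ≡⟨ cong ℤ.∣_∣ (cross-multiply X (suc d) (+ P ℤ.* numerator) X*d) ⟩
      ℤ.∣ + P ℤ.* numerator ℤ.* ↧ X ∣         ≡⟨ ℤP.abs-* (+ P ℤ.* numerator) (↧ X) ⟩
      ℤ.∣ + P ℤ.* numerator ∣ ℕ.* ℤ.∣ ↧ X ∣   ≡⟨ cong (ℕ._* ℤ.∣ ↧ X ∣) (ℤP.abs-* (+ P) numerator) ⟩
      P ℕ.* ℤ.∣ numerator ∣ ℕ.* ℤ.∣ ↧ X ∣     ∎
    p^N∣X*d : P ∣ ℤ.∣ ↥ X ∣ ℕ.* suc d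
    p^N∣X*d = subst (P ∣_) (sym |X*d|) (∣m⇒∣m*n _ (m∣m*n _))

-- The Volkenborn integral of a polynomial

Σ<-eval : ∀ M cs → Σ< M (eval cs) ≡ ι M * integral cs + ι M * ι M * lincomb (binomRemainder M) 0 cs
Σ<-eval M cs = begin
  Σ< M (eval cs)                                      ≡⟨ lincomb-Σ< M (λ x j → ι (x choose j)) 0 cs ⟩
  lincomb (λ j → Σ< M (λ x → ι (x choose j))) 0 cs    ≡⟨ lincomb-cong (hockey-stick M) 0 cs ⟩
  lincomb (λ j → ι (M choose suc j)) 0 cs             ≡⟨ lincomb-cong (choose-expansion M) 0 cs ⟩
  lincomb (λ j → ι M * ∫C j + ι M * ι M * binomRemainder M j) 0 cs
    ≡⟨ lincomb-+ _ _ 0 cs ⟩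
  lincomb (λ j → ι M * ∫C j) 0 cs + lincomb (λ j → ι M * ι M * binomRemainder M j) 0 cs
    ≡⟨ cong₂ _+_ (lincomb-* (ι M) ∫C 0 cs) (lincomb-* (ι M * ι M) (binomRemainder M) 0 cs) ⟩
  ι M * integral cs + ι M * ι M * lincomb (binomRemainder M) 0 cs ∎

average-error : ∀ M .{{_ : NonZero M}} S I R → S ≡ ι M * I + ι M * ι M * R → S * (+ 1 / M) - I ≡ ι M * R
average-error (suc m) S I R S≡ = begin
  S * u - I                           ≡⟨ cong (λ s → s * u - I) S≡ ⟩
  (m′ * I + m′ * m′ * R) * u - I
    ≡⟨ solve 4 (λ m I R u → (m :* I :+ m :* m :* R) :* u :- I := m :* R :+ (I :+ m :* R) :* (u :* m :- con 1ℚ))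
             refl m′ I R u ⟩
  m′ * R + (I + m′ * R) * (u * m′ - 1ℚ) ≡⟨ cong (λ s → m′ * R + (I + m′ * R) * (s - 1ℚ)) (1/[1+m]*[1+m]≡1 m) ⟩
  m′ * R + (I + m′ * R) * (1ℚ - 1ℚ)   ≡⟨ solve 2 (λ a b → a :+ b :* (con 1ℚ :- con 1ℚ) := a) refl (m′ * R) (I + m′ * R) ⟩
  m′ * R                              ∎
  where
  u = 1/[1+ m ]
  m′ = ι (suc m)

volkenborn-integral : ∀ p (pp : Prime p) f cs → (∀ x → f (ι x) ≡ eval cs x) →
                      IsVolkenbornIntegral p pp f (integral cs)
volkenborn-integral p pp f cs f≡eval =
  p^N-multiple⇒convergesPAdic pp {volkenbornSum p pp f} {integral cs} remainder-cleared error
  where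
  instance _ = prime⇒nonZero pp
  remainder-cleared : UniformlyCleared (λ N → lincomb (binomRemainder (p ℕ.^ N)) 0 cs)
  remainder-cleared with uniformly-lincomb (λ j → uniformly-binomRemainder j) 0 cs
  ... | d , cleared-at = d , λ N → cleared-at (p ℕ.^ N)
  error : ∀ N → volkenbornSum p pp f N - integral cs ≡ ι (p ℕ.^ N) * lincomb (binomRemainder (p ℕ.^ N)) 0 cs
  error N = average-error (p ℕ.^ N) {{ℕP.m^n≢0 p N}} _ _ _
              (trans (Σ<-cong (p ℕ.^ N) f≡eval) (Σ<-eval (p ℕ.^ N) cs))

-- The alternating sum of Bernstein integrals

module _ (n : ℕ) where

  alternatingBernsteinᴹ : Mahler
  alternatingBernsteinᴹ = Σᴹ< (suc n) (λ k → sgnℤ k ·ᴹ bernsteinᴹ k n)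

  expansionCoefficient : ℕ → ℤ
  expansionCoefficient j = + (n C j) ℤ.* sgnℤ (n ∸ j) ℤ.* + (2 ℕ.^ (n ∸ j))

  [1-2x]^nᴹ : Mahler
  [1-2x]^nᴹ = Σᴹ< (suc n) (λ j → expansionCoefficient j ·ᴹ Xᴹ^ (n ∸ j))

  ιℤ-expansionCoefficient : ∀ j → ιℤ (expansionCoefficient j) ≡ ι (n C j) * sgn (n ∸ j) * ι 2 ^ℚ (n ∸ j)
  ιℤ-expansionCoefficient j = begin
    ιℤ (+ (n C j) ℤ.* sgnℤ (n ∸ j) ℤ.* + (2 ℕ.^ (n ∸ j)))
      ≡⟨ ιℤ-* (+ (n C j) ℤ.* sgnℤ (n ∸ j)) (+ (2 ℕ.^ (n ∸ j))) ⟩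
    ιℤ (+ (n C j) ℤ.* sgnℤ (n ∸ j)) * ι (2 ℕ.^ (n ∸ j))
      ≡⟨ cong₂ _*_ (ιℤ-* (+ (n C j)) (sgnℤ (n ∸ j))) (ι-^ 2 (n ∸ j)) ⟩
    ι (n C j) * ιℤ (sgnℤ (n ∸ j)) * ι 2 ^ℚ (n ∸ j)
      ≡⟨ cong (λ s → ι (n C j) * s * ι 2 ^ℚ (n ∸ j)) (ιℤ-sgnℤ (n ∸ j)) ⟩
    ι (n C j) * sgn (n ∸ j) * ι 2 ^ℚ (n ∸ j) ∎

  eval-alternatingBernsteinᴹ : ∀ x → eval alternatingBernsteinᴹ x ≡ (1ℚ - ι 2 * ι x) ^ℚ n
  eval-alternatingBernsteinᴹ x = begin
    eval alternatingBernsteinᴹ x                     ≡⟨ lincomb-Σᴹ< _ 0 (suc n) _ ⟩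
    Σ≤ n (λ k → eval (sgnℤ k ·ᴹ bernsteinᴹ k n) x)   ≡⟨ Σ<-cong (suc n) term ⟩
    Σ≤ n (λ k → ι (n C k) * ((- ι x) ^ℚ k * (1ℚ - ι x) ^ℚ (n ∸ k)))
      ≡⟨ binomial-theorem n (- ι x) (1ℚ - ι x) ⟨
    (- ι x + (1ℚ - ι x)) ^ℚ n
      ≡⟨ cong (_^ℚ n) (solve 1 (λ y → :- y :+ (con 1ℚ :- y) := con 1ℚ :- con (ι 2) :* y) refl (ι x)) ⟩
    (1ℚ - ι 2 * ι x) ^ℚ n                            ∎
    where
    term : ∀ k → eval (sgnℤ k ·ᴹ bernsteinᴹ k n) x ≡ ι (n C k) * ((- ι x) ^ℚ k * (1ℚ - ι x) ^ℚ (n ∸ k))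
    term k = begin
      eval (sgnℤ k ·ᴹ bernsteinᴹ k n) x          ≡⟨ lincomb-·ᴹ _ 0 (sgnℤ k) (bernsteinᴹ k n) ⟩
      ιℤ (sgnℤ k) * eval (bernsteinᴹ k n) x      ≡⟨ cong₂ _*_ (ιℤ-sgnℤ k) (eval-bernsteinᴹ k n x) ⟩
      sgn k * (ι (n C k) * ι x ^ℚ k * (1ℚ - ι x) ^ℚ (n ∸ k))
        ≡⟨ solve 4 (λ s c a b → s :* (c :* a :* b) := c :* ((s :* a) :* b))
                 refl (sgn k) (ι (n C k)) (ι x ^ℚ k) ((1ℚ - ι x) ^ℚ (n ∸ k)) ⟩
      ι (n C k) * ((sgn k * ι x ^ℚ k) * (1ℚ - ι x) ^ℚ (n ∸ k))
        ≡⟨ cong (λ s → ι (n C k) * (s * (1ℚ - ι x) ^ℚ (n ∸ k))) (neg-^ℚ (ι x) k) ⟨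
      ι (n C k) * ((- ι x) ^ℚ k * (1ℚ - ι x) ^ℚ (n ∸ k)) ∎

  eval-[1-2x]^nᴹ : ∀ x → eval [1-2x]^nᴹ x ≡ (1ℚ - ι 2 * ι x) ^ℚ n
  eval-[1-2x]^nᴹ x = begin
    eval [1-2x]^nᴹ x                                              ≡⟨ lincomb-Σᴹ< _ 0 (suc n) _ ⟩
    Σ≤ n (λ j → eval (expansionCoefficient j ·ᴹ Xᴹ^ (n ∸ j)) x)   ≡⟨ Σ<-cong (suc n) term ⟩
    Σ≤ n (λ j → ι (n C j) * (1ℚ ^ℚ j * (- (ι 2 * ι x)) ^ℚ (n ∸ j)))
      ≡⟨ binomial-theorem n 1ℚ (- (ι 2 * ι x)) ⟨
    (1ℚ - ι 2 * ι x) ^ℚ n                                         ∎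
    where
    term : ∀ j → eval (expansionCoefficient j ·ᴹ Xᴹ^ (n ∸ j)) x ≡ ι (n C j) * (1ℚ ^ℚ j * (- (ι 2 * ι x)) ^ℚ (n ∸ j))
    term j = begin
      eval (expansionCoefficient j ·ᴹ Xᴹ^ (n ∸ j)) x
        ≡⟨ lincomb-·ᴹ _ 0 (expansionCoefficient j) (Xᴹ^ (n ∸ j)) ⟩
      ιℤ (expansionCoefficient j) * eval (Xᴹ^ (n ∸ j)) x
        ≡⟨ cong₂ _*_ (ιℤ-expansionCoefficient j) (eval-Xᴹ^ (n ∸ j) x) ⟩
      ι (n C j) * sgn (n ∸ j) * ι 2 ^ℚ (n ∸ j) * ι x ^ℚ (n ∸ j)
        ≡⟨ solve 4 (λ c s t y → c :* s :* t :* y := c :* (con 1ℚ :* (s :* (t :* y))))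
                 refl (ι (n C j)) (sgn (n ∸ j)) (ι 2 ^ℚ (n ∸ j)) (ι x ^ℚ (n ∸ j)) ⟩
      ι (n C j) * (1ℚ * (sgn (n ∸ j) * (ι 2 ^ℚ (n ∸ j) * ι x ^ℚ (n ∸ j))))
        ≡⟨ cong₂ (λ a b → ι (n C j) * (a * (sgn (n ∸ j) * b))) (1^ℚ≡1 j) (^ℚ-distribʳ-* (ι 2) (ι x) (n ∸ j)) ⟨
      ι (n C j) * (1ℚ ^ℚ j * (sgn (n ∸ j) * (ι 2 * ι x) ^ℚ (n ∸ j)))
        ≡⟨ cong (λ s → ι (n C j) * (1ℚ ^ℚ j * s)) (neg-^ℚ (ι 2 * ι x) (n ∸ j)) ⟨
      ι (n C j) * (1ℚ ^ℚ j * (- (ι 2 * ι x)) ^ℚ (n ∸ j)) ∎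

  integral-alternatingBernsteinᴹ : integral alternatingBernsteinᴹ ≡ Σ≤ n (λ k → sgn k * integral (bernsteinᴹ k n))
  integral-alternatingBernsteinᴹ = trans (lincomb-Σᴹ< ∫C 0 (suc n) _) (Σ<-cong (suc n) λ k →
    trans (lincomb-·ᴹ ∫C 0 (sgnℤ k) (bernsteinᴹ k n)) (cong (_* integral (bernsteinᴹ k n)) (ιℤ-sgnℤ k)))

  integral-[1-2x]^nᴹ : integral [1-2x]^nᴹ ≡ rhs7 n
  integral-[1-2x]^nᴹ = trans (lincomb-Σᴹ< ∫C 0 (suc n) _) (Σ<-cong-< (suc n) term)
    where
    summand : ℕ → ℕ → ℚ
    summand j m = ι (n C j) * sgn (n ℕ.+ m ∸ j) * (ι 2 ^ℚ (n ∸ j)) * ι (S₂ (n ∸ j) m) * (+ (m !) / suc m)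
    term : ∀ j → j ℕ.< suc n → integral (expansionCoefficient j ·ᴹ Xᴹ^ (n ∸ j)) ≡ Σ≤ (n ∸ j) (summand j)
    term j (ℕ.s≤s j≤n) = begin
      integral (expansionCoefficient j ·ᴹ Xᴹ^ (n ∸ j))
        ≡⟨ lincomb-·ᴹ ∫C 0 (expansionCoefficient j) (Xᴹ^ (n ∸ j)) ⟩
      ιℤ (expansionCoefficient j) * integral (Xᴹ^ (n ∸ j))
        ≡⟨ cong₂ _*_ (ιℤ-expansionCoefficient j) (integral-Xᴹ^ (n ∸ j)) ⟩
      c * Σ≤ (n ∸ j) (λ m → sgn m * S m * F m)     ≡⟨ *-distribˡ-Σ< (suc (n ∸ j)) c _ ⟩
      Σ≤ (n ∸ j) (λ m → c * (sgn m * S m * F m))   ≡⟨ Σ<-cong (suc (n ∸ j)) inner ⟩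
      Σ≤ (n ∸ j) (summand j)                      ∎
      where
      c = ι (n C j) * sgn (n ∸ j) * ι 2 ^ℚ (n ∸ j)
      S F : ℕ → ℚ
      S m = ι (S₂ (n ∸ j) m)
      F m = + (m !) / suc m
      inner : ∀ m → c * (sgn m * S m * F m) ≡ summand j m
      inner m = begin
        c * (sgn m * S m * F m)
          ≡⟨ solve 6 (λ b s t σ S F → b :* s :* t :* (σ :* S :* F) := b :* (s :* σ) :* t :* S :* F)
                   refl (ι (n C j)) (sgn (n ∸ j)) (ι 2 ^ℚ (n ∸ j)) (sgn m) (S m) (F m) ⟩
        ι (n C j) * (sgn (n ∸ j) * sgn m) * ι 2 ^ℚ (n ∸ j) * S m * F m
          ≡⟨ cong (λ s → ι (n C j) * s * ι 2 ^ℚ (n ∸ j) * S m * F m) (^ℚ-distribˡ-+-* (- 1ℚ) (n ∸ j) m) ⟨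
        ι (n C j) * sgn (n ∸ j ℕ.+ m) * ι 2 ^ℚ (n ∸ j) * S m * F m
          ≡⟨ cong (λ k → ι (n C j) * sgn k * ι 2 ^ℚ (n ∸ j) * S m * F m) (ℕP.+-∸-comm m j≤n) ⟨
        summand j m ∎

  alternating-sum-of-integrals : Σ≤ n (λ k → sgn k * integral (bernsteinᴹ k n)) ≡ rhs7 n
  alternating-sum-of-integrals = begin
    Σ≤ n (λ k → sgn k * integral (bernsteinᴹ k n))  ≡⟨ integral-alternatingBernsteinᴹ ⟨
    integral alternatingBernsteinᴹ                  ≡⟨ integral-cong alternatingBernsteinᴹ [1-2x]^nᴹ same-values ⟩
    integral [1-2x]^nᴹ                              ≡⟨ integral-[1-2x]^nᴹ ⟩
    rhs7 n                                          ∎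
    where
    same-values : ∀ x → eval alternatingBernsteinᴹ x ≡ eval [1-2x]^nᴹ x
    same-values x = trans (eval-alternatingBernsteinᴹ x) (sym (eval-[1-2x]^nᴹ x))

mainTheorem7 : (p : ℕ) → (pp : Prime p) → p ≢ 2 → (n : ℕ) →
    Σ (ℕ → ℚ) (λ I →
      ((k : ℕ) → k ≤ n → IsVolkenbornIntegral p pp (bernstein k n) (I k)) ×
      (Σ≤ n (λ k → sgn k * I k) ≡ rhs7 n))
mainTheorem7 p pp _ n =
  (λ k → integral (bernsteinᴹ k n)) ,
  (λ k _ → volkenborn-integral p pp (bernstein k n) (bernsteinᴹ k n) (λ x → sym (eval-bernsteinᴹ k n x))) ,
  alternating-sum-of-integrals n
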